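{- Let $A$ and $B$ be $0$-$1$ matrices, neither of which is all-zero, and let $P=\begin{pmatrix} A & \mathbf{0}\\ \mathbf{0} & B\end{pmatrix}$, where the $\mathbf{0}$ blocks are all-zero matrices of the appropriate sizes. Then $sat(P,n)=\Theta(n)$.
   Context: All matrices are $0$-$1$ matrices; an $m\times n$ matrix has $m$ rows and $n$ columns. The weight of a matrix is its number of $1$ entries. A matrix $M$ contains a $k\times l$ pattern $P$ if there are rows $r_1<\dots<r_k$ and columns $c_1<\dots<c_l$ of $M$ such that $M(r_a,c_b)=1$ whenever $P(a,b)=1$; otherwise $M$ avoids $P$. A matrix $M$ is saturating for $P$ if $M$ avoids $P$ and changing any single $0$ entry of $M$ to $1$ yields a matrix containing $P$. $sat(P,m,n)$ is the minimum weight of an $m\times n$ matrix saturating for $P$, and $sat(P,n)=sat(P,n,n)$. -}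

module Defs where

open import Data.Nat using (ℕ; zero; suc; _+_; _*_; _≤_)
open import Data.Fin using (Fin; zero; suc; splitAt; _<_; _≟_)
open import Data.Bool using (Bool; true; false; if_then_else_; _∧_)
open import Data.Sum using (inj₁; inj₂)
open import Data.Product using (Σ; ∃; _×_; _,_)
open import Relation.Nullary using (¬_)
open import Relation.Nullary.Decidable using (⌊_⌋)
open import Relation.Binary.PropositionalEquality using (_≡_)

Matrix : ℕ → ℕ → Set
Matrix m n = Fin m → Fin n → Bool

sumFin : ∀ {n} → (Fin n → ℕ) → ℕ
sumFin {zero}  f = 0
sumFin {suc n} f = f zero + sumFin (λ i → f (suc i))

weight : ∀ {m n} → Matrix m n → ℕ
weight M = sumFin (λ i → sumFin (λ j → if M i j then 1 else 0))

StrictlyIncreasing : ∀ {k m} → (Fin k → Fin m) → Set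
StrictlyIncreasing f = ∀ i j → i < j → f i < f j

Contains : ∀ {m n k l} → Matrix m n → Matrix k l → Set
Contains {m} {n} {k} {l} M P =
  Σ (Fin k → Fin m) λ r → Σ (Fin l → Fin n) λ c →
    StrictlyIncreasing r × StrictlyIncreasing c ×
    (∀ a b → P a b ≡ true → M (r a) (c b) ≡ true)

Avoids : ∀ {m n k l} → Matrix m n → Matrix k l → Set
Avoids M P = ¬ Contains M P

setOne : ∀ {m n} → Matrix m n → Fin m → Fin n → Matrix m n
setOne M i j r c = if ⌊ r ≟ i ⌋ ∧ ⌊ c ≟ j ⌋ then true else M r c

Saturating : ∀ {m n k l} → Matrix k l → Matrix m n → Set
Saturating P M = Avoids M P × (∀ i j → M i j ≡ false → Contains (setOne M i j) P)

IsSat : ∀ {k l} → Matrix k l → ℕ → ℕ → ℕ → Set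
IsSat P m n s =
  (Σ (Matrix m n) λ M → Saturating P M × weight M ≡ s) ×
  (∀ (M : Matrix m n) → Saturating P M → s ≤ weight M)

NonZeroMatrix : ∀ {k l} → Matrix k l → Set
NonZeroMatrix A = ∃ λ a → ∃ λ b → A a b ≡ true

blockDiag : ∀ {k₁ l₁ k₂ l₂} → Matrix k₁ l₁ → Matrix k₂ l₂ → Matrix (k₁ + k₂) (l₁ + l₂)
blockDiag {k₁} {l₁} A B i j with splitAt k₁ i | splitAt l₁ j
... | inj₁ a | inj₁ b = A a b
... | inj₂ a | inj₂ b = B a b
... | inj₁ _ | inj₂ _ = false
... | inj₂ _ | inj₁ _ = false

-- Lower bound: a matrix saturating P = (A 0; 0 B) has no empty row. If row r were empty, adding a 1
-- at (r, j) creates an occurrence of P through (r, j), using there an entry of the A-block or of the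
-- B-block. Through the first column it must be the A-block and through the last one the B-block, so
-- for some j there are an A-occurrence through (r, j) and a B-occurrence through (r, j + 1); the
-- A-part of the second and the B-part of the first then form an occurrence of P in the matrix itself.
--
-- Upper bound: for a 1-entry (a, b) of a k × l pattern, fill all rows of a (d + k) × (d + k) matrix
-- except the band of rows a, …, a + d. Row a of an occurrence would have to land in the band, so this
-- avoids the pattern; in any saturating extension each band row has fewer than l ones, since
-- otherwise the full rows around it complete an occurrence. Hence the weight is at most (k + l)(d + k).

module Submission where

open import Defs
open import Level using (0ℓ)
open import Algebra.Properties.CommutativeSemigroup using (interchange)
open import Data.Bool using (Bool; true; false; _∨_; if_then_else_)
open import Data.Bool.Properties using (¬-not; ∨-zeroʳ) renaming (_≟_ to _≟ᵇ_)
open import Data.Fin as Fin using (Fin; zero; suc; toℕ; fromℕ; inject₁; inject≤; _↑ˡ_; _↑ʳ_)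
open import Data.Fin.Induction using (<-weakInduction; >-weakInduction)
import Data.Fin.Properties as Finₚ
open import Data.List using (List; []; _∷_; allFin; cartesianProduct)
open import Data.List.Membership.Propositional using (_∈_)
open import Data.List.Membership.Propositional.Properties using (∈-allFin; ∈-cartesianProduct⁺)
open import Data.List.Relation.Unary.Any using (here; there)
open import Data.Nat as ℕ using (ℕ; zero; suc; _+_; _*_; _∸_; _≤_; _<_; z≤n; s≤s; _<?_)
import Data.Nat.Properties as ℕₚ
open import Data.Nat.Solver using (module +-*-Solver)
open import Data.Product using (Σ; ∃; _×_; _,_; proj₁; proj₂)
open import Data.Sum using (_⊎_; inj₁; inj₂)
open import Data.Vec.Functional using (head; tail) renaming (_∷_ to _◂_)
open import Data.Vec.Functional.Relation.Binary.Pointwise using (Pointwise)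
open import Function using (_∘_)
open import Relation.Binary using (Rel; Reflexive; _Respects_; tri<; tri≈; tri>)
open import Relation.Binary.PropositionalEquality
open import Relation.Nullary using (Dec; yes; no; ¬_; does; contradiction)
open import Relation.Nullary.Decidable using (_×-dec_; _→-dec_; ¬?; map′; dec-true; dec-false)
open import Relation.Unary using (Pred; Decidable)

Searchable : (X : Set) → Rel X 0ℓ → Set₁
Searchable X _≈_ = (Q : Pred X 0ℓ) → Q Respects _≈_ → Decidable Q → Dec (∃ Q)

Fin-searchable : ∀ {n} → Searchable (Fin n) _≡_
Fin-searchable _ _ Q? = Finₚ.any? Q?

Bool-searchable : Searchable Bool _≡_
Bool-searchable Q _ Q? with Q? true | Q? false
... | yes q | _     = yes (true , q)
... | no _  | yes q = yes (false , q)
... | no ¬t | no ¬f = no λ { (true , q) → ¬t q ; (false , q) → ¬f q }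

-- Without function extensionality, a predicate on functions is only searchable if it respects
-- pointwise equality.
Vector-searchable : ∀ {X _≈_} → Reflexive _≈_ → Searchable X _≈_ →
                    ∀ n → Searchable (Fin n → X) (Pointwise _≈_)
Vector-searchable ≈-refl search zero Q resp Q? =
  map′ (λ q → empty , q) (λ (f , q) → resp {f} {empty} (λ ()) q) (Q? empty)
  where
  empty : Fin 0 → _
  empty ()
Vector-searchable {X} {_≈_} ≈-refl search (suc n) Q resp Q? =
  map′ (λ (x , f , q) → x ◂ f , q) (λ (f , q) → head f , tail f , resp ◂-head-tail q)
       (search (λ x → ∃ λ f → Q (x ◂ f)) resp-head
               (λ x → Vector-searchable ≈-refl search n (λ f → Q (x ◂ f)) (resp ∘ resp-tail) (Q? ∘ (x ◂_))))
  where
  ◂-head-tail : ∀ {f} → Pointwise _≈_ f (head f ◂ tail f)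
  ◂-head-tail zero    = ≈-refl
  ◂-head-tail (suc i) = ≈-refl

  resp-tail : ∀ {x f g} → Pointwise _≈_ f g → Pointwise _≈_ (x ◂ f) (x ◂ g)
  resp-tail f≈g zero    = ≈-refl
  resp-tail f≈g (suc i) = f≈g i

  resp-head : (λ x → ∃ λ f → Q (x ◂ f)) Respects _≈_
  resp-head x≈y (f , q) = f , resp (λ { zero → x≈y ; (suc i) → ≈-refl }) q

_≐_ : ∀ {m n} → Rel (Matrix m n) 0ℓ
_≐_ = Pointwise (Pointwise _≡_)

Matrix-searchable : ∀ m n → Searchable (Matrix m n) _≐_
Matrix-searchable m n = Vector-searchable (λ _ → refl) (Vector-searchable refl Bool-searchable n) m

least-witness : ∀ {Q : Pred ℕ 0ℓ} → Decidable Q → ∀ {w} → Q w → ∃ λ s → Q s × (∀ {v} → Q v → s ≤ v)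
least-witness {Q} Q? {w} q = search w 0 (λ ()) (subst Q (sym (ℕₚ.+-identityʳ w)) q)
  where
  search : ∀ gap t → (∀ {v} → v < t → ¬ Q v) → Q (gap + t) → ∃ λ s → Q s × (∀ {v} → Q v → s ≤ v)
  search gap t none-below q with Q? t
  search gap       t none-below q | yes qt = t , qt , λ qv → ℕₚ.≮⇒≥ λ v<t → none-below v<t qv
  search zero      t none-below q | no ¬qt = contradiction q ¬qt
  search (suc gap) t none-below q | no ¬qt =
    search gap (suc t) none-to-t (subst Q (sym (ℕₚ.+-suc gap t)) q)
    where
    none-to-t : ∀ {v} → v < suc t → ¬ Q v
    none-to-t v<1+t with ℕₚ.m<1+n⇒m<n∨m≡n v<1+t
    ... | inj₁ v<t  = none-below v<t
    ... | inj₂ refl = ¬qt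

StrictlyIncreasing? : ∀ {a b} (f : Fin a → Fin b) → Dec (StrictlyIncreasing f)
StrictlyIncreasing? f = Finₚ.all? λ i → Finₚ.all? λ j → (i Finₚ.<? j) →-dec (f i Finₚ.<? f j)

StrictlyIncreasing-resp : ∀ {a b} → StrictlyIncreasing {a} {b} Respects Pointwise _≡_
StrictlyIncreasing-resp f≗g inc i j i<j = subst₂ Fin._<_ (f≗g i) (f≗g j) (inc i j i<j)

Embeds : ∀ {k l m n} → Matrix k l → Matrix m n → (Fin k → Fin m) → (Fin l → Fin n) → Set
Embeds P M rows cols = ∀ a b → P a b ≡ true → M (rows a) (cols b) ≡ true

_⊆_ : ∀ {m n} → Rel (Matrix m n) 0ℓ
M ⊆ M′ = ∀ i j → M i j ≡ true → M′ i j ≡ true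

module _ {m n : ℕ} {M : Matrix m n} (i : Fin m) (j : Fin n) where

  setOne-self : setOne M i j i j ≡ true
  setOne-self with i Finₚ.≟ i | j Finₚ.≟ j
  ... | yes _ | yes _  = refl
  ... | no i≢i | _     = contradiction refl i≢i
  ... | yes _ | no j≢j = contradiction refl j≢j

  setOne-elsewhere : ∀ {r c} → ¬ (r ≡ i × c ≡ j) → setOne M i j r c ≡ M r c
  setOne-elsewhere {r} {c} ≢ij with r Finₚ.≟ i | c Finₚ.≟ j
  ... | yes r≡i | yes c≡j = contradiction (r≡i , c≡j) ≢ij
  ... | yes _   | no _    = refl
  ... | no _    | yes _   = refl
  ... | no _    | no _    = refl

  ⊆-setOne : M ⊆ setOne M i j
  ⊆-setOne r c e with r Finₚ.≟ i | c Finₚ.≟ j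
  ... | yes _ | yes _ = refl
  ... | yes _ | no _  = e
  ... | no _  | yes _ = e
  ... | no _  | no _  = e

module _ {m n : ℕ} {M M′ : Matrix m n} where

  setOne-mono : M ⊆ M′ → ∀ i j → setOne M i j ⊆ setOne M′ i j
  setOne-mono M⊆M′ i j r c e with r Finₚ.≟ i | c Finₚ.≟ j
  ... | yes _ | yes _ = refl
  ... | yes _ | no _  = M⊆M′ r c e
  ... | no _  | yes _ = M⊆M′ r c e
  ... | no _  | no _  = M⊆M′ r c e

  setOne-resp : M ≐ M′ → ∀ i j → setOne M i j ≐ setOne M′ i j
  setOne-resp M≐M′ i j r c with r Finₚ.≟ i | c Finₚ.≟ j
  ... | yes _ | yes _ = refl
  ... | yes _ | no _  = M≐M′ r c
  ... | no _  | yes _ = M≐M′ r c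
  ... | no _  | no _  = M≐M′ r c

module _ {k l} (P : Matrix k l) {m n : ℕ} where

  Embeds? : ∀ (M : Matrix m n) rows cols → Dec (Embeds P M rows cols)
  Embeds? M rows cols =
    Finₚ.all? λ a → Finₚ.all? λ b → (P a b ≟ᵇ true) →-dec (M (rows a) (cols b) ≟ᵇ true)

  Contains? : ∀ (M : Matrix m n) → Dec (Contains M P)
  Contains? M = Vector-searchable refl Fin-searchable k _ resp-rows λ rows →
    Vector-searchable refl Fin-searchable l _ (resp-cols rows) λ cols →
      StrictlyIncreasing? rows ×-dec StrictlyIncreasing? cols ×-dec Embeds? M rows cols
    where
    resp-rows : (λ rows → ∃ λ cols → StrictlyIncreasing rows × StrictlyIncreasing cols × Embeds P M rows cols)
                Respects Pointwise _≡_
    resp-rows r≗r′ (cols , r-inc , c-inc , emb) =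
      cols , StrictlyIncreasing-resp r≗r′ r-inc , c-inc ,
      λ a b one → subst (λ x → M x (cols b) ≡ true) (r≗r′ a) (emb a b one)

    resp-cols : ∀ rows → (λ cols → StrictlyIncreasing rows × StrictlyIncreasing cols × Embeds P M rows cols)
                Respects Pointwise _≡_
    resp-cols rows c≗c′ (r-inc , c-inc , emb) =
      r-inc , StrictlyIncreasing-resp c≗c′ c-inc ,
      λ a b one → subst (λ y → M (rows a) y ≡ true) (c≗c′ b) (emb a b one)

  Contains-mono : ∀ {M M′ : Matrix m n} → M ⊆ M′ → Contains M P → Contains M′ P
  Contains-mono M⊆M′ (rows , cols , r-inc , c-inc , emb) =
    rows , cols , r-inc , c-inc , λ a b one → M⊆M′ _ _ (emb a b one)

  Contains-resp : (λ M → Contains M P) Respects _≐_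
  Contains-resp M≐M′ = Contains-mono λ i j e → trans (sym (M≐M′ i j)) e

  Saturating? : ∀ (M : Matrix m n) → Dec (Saturating P M)
  Saturating? M = ¬? (Contains? M) ×-dec
    (Finₚ.all? λ i → Finₚ.all? λ j → (M i j ≟ᵇ false) →-dec Contains? (setOne M i j))

  Saturating-resp : Saturating P Respects _≐_
  Saturating-resp M≐M′ (avoids , saturates) =
    (λ c → avoids (Contains-resp (λ i j → sym (M≐M′ i j)) c)) ,
    λ i j zero′ → Contains-resp (setOne-resp M≐M′ i j) (saturates i j (trans (M≐M′ i j) zero′))

sumFin-cong : ∀ {n} {f g : Fin n → ℕ} → (∀ i → f i ≡ g i) → sumFin f ≡ sumFin g
sumFin-cong {zero}  f≗g = refl
sumFin-cong {suc n} f≗g = cong₂ _+_ (f≗g zero) (sumFin-cong (f≗g ∘ suc))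

sumFin-mono : ∀ {n} {f g : Fin n → ℕ} → (∀ i → f i ≤ g i) → sumFin f ≤ sumFin g
sumFin-mono {zero}  f≤g = z≤n
sumFin-mono {suc n} f≤g = ℕₚ.+-mono-≤ (f≤g zero) (sumFin-mono (f≤g ∘ suc))

sumFin-+ : ∀ {n} (f g : Fin n → ℕ) → sumFin (λ i → f i + g i) ≡ sumFin f + sumFin g
sumFin-+ {zero}  f g = refl
sumFin-+ {suc n} f g = begin
  f zero + g zero + sumFin (λ i → f (suc i) + g (suc i))
    ≡⟨ cong (f zero + g zero +_) (sumFin-+ (f ∘ suc) (g ∘ suc)) ⟩
  f zero + g zero + (sumFin (f ∘ suc) + sumFin (g ∘ suc))
    ≡⟨ interchange ℕₚ.+-commutativeSemigroup (f zero) (g zero) (sumFin (f ∘ suc)) (sumFin (g ∘ suc)) ⟩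
  f zero + sumFin (f ∘ suc) + (g zero + sumFin (g ∘ suc)) ∎
  where open ≡-Reasoning

sumFin-* : ∀ {n} c (f : Fin n → ℕ) → sumFin (λ i → c * f i) ≡ c * sumFin f
sumFin-* {zero}  c f = sym (ℕₚ.*-zeroʳ c)
sumFin-* {suc n} c f =
  trans (cong (c * f zero +_) (sumFin-* c (f ∘ suc))) (sym (ℕₚ.*-distribˡ-+ c (f zero) _))

sumFin-const : ∀ n c → sumFin {n} (λ _ → c) ≡ n * c
sumFin-const zero    c = refl
sumFin-const (suc n) c = cong (c +_) (sumFin-const n c)

≤-sumFin : ∀ {n} (f : Fin n → ℕ) j → f j ≤ sumFin f
≤-sumFin f zero    = ℕₚ.m≤m+n _ _
≤-sumFin f (suc j) = ℕₚ.≤-trans (≤-sumFin (f ∘ suc) j) (ℕₚ.m≤n+m _ _)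

𝟙 : Bool → ℕ
𝟙 b = if b then 1 else 0

count : ∀ {n} → (Fin n → Bool) → ℕ
count v = sumFin (𝟙 ∘ v)

𝟙≤1 : ∀ b → 𝟙 b ≤ 1
𝟙≤1 true  = ℕₚ.≤-refl
𝟙≤1 false = z≤n

count≤length : ∀ {n} (v : Fin n → Bool) → count v ≤ n
count≤length {n} v =
  ℕₚ.≤-trans (sumFin-mono (𝟙≤1 ∘ v)) (ℕₚ.≤-reflexive (trans (sumFin-const n 1) (ℕₚ.*-identityʳ n)))

count-∨ : ∀ {n} (u v : Fin n → Bool) → count (λ i → u i ∨ v i) ≤ count u + count v
count-∨ u v =
  ℕₚ.≤-trans (sumFin-mono (λ i → 𝟙-∨ (u i) (v i))) (ℕₚ.≤-reflexive (sumFin-+ (𝟙 ∘ u) (𝟙 ∘ v)))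
  where
  𝟙-∨ : ∀ x y → 𝟙 (x ∨ y) ≤ 𝟙 x + 𝟙 y
  𝟙-∨ true  y = s≤s z≤n
  𝟙-∨ false y = ℕₚ.≤-refl

count-below : ∀ n a → count {n} (λ i → does (toℕ i <? a)) ≤ a
count-below zero    a       = z≤n
count-below (suc n) zero    = ℕₚ.≤-reflexive (trans (sumFin-const n 0) (ℕₚ.*-zeroʳ n))
count-below (suc n) (suc a) = s≤s (count-below n a)

count-above : ∀ n c → count {n} (λ i → does (c <? toℕ i)) ≤ n ∸ suc c
count-above zero    c       = z≤n
count-above (suc n) zero    = ℕₚ.≤-reflexive (trans (sumFin-const n 1) (ℕₚ.*-identityʳ n))
count-above (suc n) (suc c) = count-above n c

weight-resp : ∀ {m n} {M M′ : Matrix m n} → M ≐ M′ → weight M ≡ weight M′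
weight-resp M≐M′ = sumFin-cong λ i → sumFin-cong λ j → cong 𝟙 (M≐M′ i j)

isSat-≤-weight : ∀ {k l m n} (P : Matrix k l) (M : Matrix m n) → Saturating P M →
                 ∃ λ s → IsSat P m n s × s ≤ weight M
isSat-≤-weight {m = m} {n} P M sat
  with least-witness weight-attained? (M , sat , refl)
  where
  weight-attained? : Decidable (λ w → ∃ λ M → Saturating P M × weight M ≡ w)
  weight-attained? w = Matrix-searchable m n _
    (λ M≐M′ (sat′ , eq) → Saturating-resp P M≐M′ sat′ , trans (sym (weight-resp M≐M′)) eq)
    (λ M → Saturating? P M ×-dec (weight M ℕ.≟ w))
... | s , attained , least = s , (attained , λ M′ sat′ → least (M′ , sat′ , refl)) , least (M , sat , refl)

module GreedySaturation {k l m n : ℕ} (P : Matrix k l) where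

  -- Being filled at a position survives adding further ones, so one greedy pass over all positions saturates.
  FilledAt : Matrix m n → Fin m × Fin n → Set
  FilledAt M (i , j) = M i j ≡ true ⊎ Contains (setOne M i j) P

  FilledAt-mono : ∀ {M M′} → M ⊆ M′ → ∀ p → FilledAt M p → FilledAt M′ p
  FilledAt-mono M⊆M′ (i , j) (inj₁ one)    = inj₁ (M⊆M′ i j one)
  FilledAt-mono M⊆M′ (i , j) (inj₂ occurs) = inj₂ (Contains-mono P (setOne-mono M⊆M′ i j) occurs)

  fill : Matrix m n → Fin m × Fin n → Matrix m n
  fill M (i , j) with Contains? P (setOne M i j)
  ... | yes _ = M
  ... | no _  = setOne M i j

  ⊆-fill : ∀ M p → M ⊆ fill M p
  ⊆-fill M (i , j) with Contains? P (setOne M i j)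
  ... | yes _ = λ _ _ one → one
  ... | no _  = ⊆-setOne {M = M} i j

  fill-avoids : ∀ M p → Avoids M P → Avoids (fill M p) P
  fill-avoids M (i , j) avoids with Contains? P (setOne M i j)
  ... | yes _        = avoids
  ... | no ¬contains = ¬contains

  fill-filledAt : ∀ M p → FilledAt (fill M p) p
  fill-filledAt M (i , j) with Contains? P (setOne M i j)
  ... | yes contains = inj₂ contains
  ... | no _         = inj₁ (setOne-self {M = M} i j)

  fillAll : Matrix m n → List (Fin m × Fin n) → Matrix m n
  fillAll M []       = M
  fillAll M (p ∷ ps) = fillAll (fill M p) ps

  ⊆-fillAll : ∀ M ps → M ⊆ fillAll M ps
  ⊆-fillAll M []       i j one = one
  ⊆-fillAll M (p ∷ ps) i j one = ⊆-fillAll (fill M p) ps i j (⊆-fill M p i j one)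

  fillAll-avoids : ∀ M ps → Avoids M P → Avoids (fillAll M ps) P
  fillAll-avoids M []       avoids = avoids
  fillAll-avoids M (p ∷ ps) avoids = fillAll-avoids (fill M p) ps (fill-avoids M p avoids)

  fillAll-filledAt : ∀ M ps {p} → p ∈ ps → FilledAt (fillAll M ps) p
  fillAll-filledAt M (p ∷ ps) (here refl) = FilledAt-mono (⊆-fillAll (fill M p) ps) p (fill-filledAt M p)
  fillAll-filledAt M (q ∷ ps) (there p∈ps) = fillAll-filledAt (fill M q) ps p∈ps

  saturate : (M : Matrix m n) → Avoids M P → ∃ λ M′ → Saturating P M′ × M ⊆ M′
  saturate M avoids = fillAll M positions , (fillAll-avoids M positions avoids , saturates) , ⊆-fillAll M positions
    where
    positions : List (Fin m × Fin n)
    positions = cartesianProduct (allFin m) (allFin n)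

    saturates : ∀ i j → fillAll M positions i j ≡ false → Contains (setOne (fillAll M positions) i j) P
    saturates i j zero′ with fillAll-filledAt M positions (∈-cartesianProduct⁺ (∈-allFin i) (∈-allFin j))
    ... | inj₁ one    = contradiction (trans (sym one) zero′) λ ()
    ... | inj₂ occurs = occurs

open GreedySaturation using (saturate)

inject₁<suc : ∀ {n} (i : Fin n) → inject₁ i Fin.< suc i
inject₁<suc i = s≤s (ℕₚ.≤-reflexive (Finₚ.toℕ-inject₁ i))

index≤image : ∀ {k N} {ρ : Fin k → Fin N} → StrictlyIncreasing ρ → ∀ x → toℕ x ≤ toℕ (ρ x)
index≤image {suc k} {ρ = ρ} inc = <-weakInduction (λ x → toℕ x ≤ toℕ (ρ x)) z≤n step
  where
  step : ∀ i → toℕ (inject₁ i) ≤ toℕ (ρ (inject₁ i)) → toℕ (suc i) ≤ toℕ (ρ (suc i))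
  step i ih = ℕₚ.≤-trans (s≤s (subst (_≤ toℕ (ρ (inject₁ i))) (Finₚ.toℕ-inject₁ i) ih))
                         (inc _ _ (inject₁<suc i))

image+size≤index+range : ∀ {k N} {ρ : Fin k → Fin N} → StrictlyIncreasing ρ →
                         ∀ x → toℕ (ρ x) + k ≤ toℕ x + N
image+size≤index+range {suc k} {N} {ρ} inc = >-weakInduction Room last step
  where
  Room : Fin (suc k) → Set
  Room x = toℕ (ρ x) + suc k ≤ toℕ x + N

  last : Room (fromℕ k)
  last rewrite Finₚ.toℕ-fromℕ k | ℕₚ.+-suc (toℕ (ρ (fromℕ k))) k | ℕₚ.+-comm k N =
    ℕₚ.+-monoˡ-≤ k (Finₚ.toℕ<n (ρ (fromℕ k)))

  step : ∀ i → Room (suc i) → Room (inject₁ i)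
  step i ih rewrite Finₚ.toℕ-inject₁ i =
    ℕ.s≤s⁻¹ (ℕₚ.≤-trans (ℕₚ.+-monoˡ-≤ (suc k) (inc _ _ (inject₁<suc i))) ih)

image≤slack+index : ∀ {k} d {ρ : Fin k → Fin (d + k)} → StrictlyIncreasing ρ →
                    ∀ x → toℕ (ρ x) ≤ d + toℕ x
image≤slack+index {k} d {ρ} inc x = ℕₚ.+-cancelʳ-≤ k (toℕ (ρ x)) (d + toℕ x) (begin
  toℕ (ρ x) + k    ≤⟨ image+size≤index+range inc x ⟩
  toℕ x + (d + k)  ≡⟨ sym (ℕₚ.+-assoc (toℕ x) d k) ⟩
  toℕ x + d + k    ≡⟨ cong (_+ k) (ℕₚ.+-comm (toℕ x) d) ⟩
  d + toℕ x + k    ∎)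
  where open ℕₚ.≤-Reasoning

increasing-ones : ∀ {n} (v : Fin n → Bool) l → l ≤ count v →
                  ∃ λ (c : Fin l → Fin n) → StrictlyIncreasing c × (∀ y → v (c y) ≡ true)
increasing-ones {zero} v zero z≤n = (λ ()) , (λ ()) , (λ ())
increasing-ones {suc n} v l l≤ with v zero in v₀≡
... | false with increasing-ones (v ∘ suc) l l≤
...   | c , inc , ones = suc ∘ c , (λ i j i<j → s≤s (inc i j i<j)) , ones
increasing-ones {suc n} v zero    l≤       | true = (λ ()) , (λ ()) , (λ ())
increasing-ones {suc n} v (suc l) (s≤s l≤) | true with increasing-ones (v ∘ suc) l l≤
... | c , inc , ones = zero ◂ (suc ∘ c) , inc′ , ones′
  where
  inc′ : StrictlyIncreasing (zero ◂ (suc ∘ c))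
  inc′ zero    (suc j) _         = s≤s z≤n
  inc′ (suc i) (suc j) (s≤s i<j) = s≤s (inc i j i<j)

  ones′ : ∀ y → v ((zero ◂ (suc ∘ c)) y) ≡ true
  ones′ zero    = v₀≡
  ones′ (suc y) = ones y

module LinearUpperBound {k l} (P : Matrix k l) {a : Fin k} {b : Fin l} (one : P a b ≡ true) (d : ℕ) where

  N : ℕ
  N = d + k

  below above outside : Fin N → Bool
  below i   = does (toℕ i <? toℕ a)
  above i   = does (d + toℕ a <? toℕ i)
  outside i = below i ∨ above i

  frame : Matrix N N
  frame i _ = outside i

  outside-below : ∀ {i} → toℕ i < toℕ a → outside i ≡ true
  outside-below {i} i<a = cong (_∨ above i) (dec-true (toℕ i <? toℕ a) i<a)

  outside-above : ∀ {i} → d + toℕ a < toℕ i → outside i ≡ true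
  outside-above {i} a+d<i = trans (cong (below i ∨_) (dec-true (d + toℕ a <? toℕ i) a+d<i)) (∨-zeroʳ (below i))

  frame-avoids : Avoids frame P
  frame-avoids (rows , _ , rows-inc , _ , emb) = contradiction (trans (sym inside) (emb a b one)) λ ()
    where
    inside : outside (rows a) ≡ false
    inside = cong₂ _∨_ (dec-false (toℕ (rows a) <? toℕ a) (ℕₚ.≤⇒≯ (index≤image rows-inc a)))
                       (dec-false (d + toℕ a <? toℕ (rows a)) (ℕₚ.≤⇒≯ (image≤slack+index d rows-inc a)))

  inside-band : ∀ {i} → outside i ≡ false → toℕ a ≤ toℕ i × toℕ i ≤ d + toℕ a
  inside-band inside =
    ℕₚ.≮⇒≥ (λ i<a → contradiction (trans (sym inside) (outside-below i<a)) λ ()) ,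
    ℕₚ.≮⇒≥ (λ a+d<i → contradiction (trans (sym inside) (outside-above a+d<i)) λ ())

  band-row-sparse : ∀ {M} → frame ⊆ M → Avoids M P → ∀ i → outside i ≡ false → count (M i) < l
  band-row-sparse {M} frame⊆M avoids i inside = ℕₚ.≰⇒> λ l≤ →
    let (cols , cols-inc , cols-ones) = increasing-ones (M i) l l≤
    in avoids (rows , cols , rows-inc , cols-inc , λ x y _ → rows-ones x (cols y) (cols-ones y))
    where
    a≤i : toℕ a ≤ toℕ i
    a≤i = proj₁ (inside-band inside)

    i≤a+d : toℕ i ≤ d + toℕ a
    i≤a+d = proj₂ (inside-band inside)

    -- Rows before a go to the full rows above the band, a goes to i, rows after a to the full rows below.
    rows : Fin k → Fin N
    rows x with ℕₚ.<-cmp (toℕ x) (toℕ a)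
    ... | tri< _ _ _ = inject≤ x (ℕₚ.m≤n+m k d)
    ... | tri≈ _ _ _ = i
    ... | tri> _ _ _ = d ↑ʳ x

    rows-inc : StrictlyIncreasing rows
    rows-inc x y x<y with ℕₚ.<-cmp (toℕ x) (toℕ a) | ℕₚ.<-cmp (toℕ y) (toℕ a)
    ... | tri< _ _ _   | tri< _ _ _   rewrite Finₚ.toℕ-inject≤ x (ℕₚ.m≤n+m k d)
                                             | Finₚ.toℕ-inject≤ y (ℕₚ.m≤n+m k d) = x<y
    ... | tri< x<a _ _ | tri≈ _ _ _   rewrite Finₚ.toℕ-inject≤ x (ℕₚ.m≤n+m k d) = ℕₚ.<-≤-trans x<a a≤i
    ... | tri< _ _ _   | tri> _ _ _   rewrite Finₚ.toℕ-inject≤ x (ℕₚ.m≤n+m k d) | Finₚ.toℕ-↑ʳ d y =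
      ℕₚ.<-≤-trans x<y (ℕₚ.m≤n+m (toℕ y) d)
    ... | tri≈ _ _ _   | tri> _ _ a<y rewrite Finₚ.toℕ-↑ʳ d y = ℕₚ.≤-<-trans i≤a+d (ℕₚ.+-monoʳ-< d a<y)
    ... | tri> _ _ _   | tri> _ _ _   rewrite Finₚ.toℕ-↑ʳ d x | Finₚ.toℕ-↑ʳ d y = ℕₚ.+-monoʳ-< d x<y
    ... | tri≈ _ x≡a _ | tri< y<a _ _ = contradiction (ℕₚ.<-trans x<y y<a) (ℕₚ.<-irrefl x≡a)
    ... | tri≈ _ x≡a _ | tri≈ _ y≡a _ = contradiction x<y (ℕₚ.<-irrefl (trans x≡a (sym y≡a)))
    ... | tri> _ _ a<x | tri< y<a _ _ = contradiction (ℕₚ.<-trans a<x x<y) (ℕₚ.<-asym y<a)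
    ... | tri> _ _ a<x | tri≈ _ y≡a _ = contradiction (ℕₚ.<-trans a<x x<y) (ℕₚ.<-irrefl (sym y≡a))

    rows-ones : ∀ x j → M i j ≡ true → M (rows x) j ≡ true
    rows-ones x j i-one with ℕₚ.<-cmp (toℕ x) (toℕ a)
    ... | tri< x<a _ _ = frame⊆M _ j (outside-below
                           (subst (_< toℕ a) (sym (Finₚ.toℕ-inject≤ x (ℕₚ.m≤n+m k d))) x<a))
    ... | tri≈ _ _ _   = i-one
    ... | tri> _ _ a<x = frame⊆M _ j (outside-above
                           (subst (d + toℕ a <_) (sym (Finₚ.toℕ-↑ʳ d x)) (ℕₚ.+-monoʳ-< d a<x)))

  count-outside : count outside ≤ k
  count-outside = begin
    count outside                    ≤⟨ count-∨ below above ⟩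
    count below + count above        ≤⟨ ℕₚ.+-mono-≤ (count-below N (toℕ a)) (count-above N (d + toℕ a)) ⟩
    toℕ a + (N ∸ suc (d + toℕ a))    ≡⟨ cong (λ z → toℕ a + (N ∸ z)) (sym (ℕₚ.+-suc d (toℕ a))) ⟩
    toℕ a + (N ∸ (d + suc (toℕ a)))  ≡⟨ cong (toℕ a +_) (ℕₚ.[m+n]∸[m+o]≡n∸o d k (suc (toℕ a))) ⟩
    toℕ a + (k ∸ suc (toℕ a))        ≤⟨ ℕₚ.n≤1+n _ ⟩
    suc (toℕ a) + (k ∸ suc (toℕ a))  ≡⟨ ℕₚ.m+[n∸m]≡n (Finₚ.toℕ<n a) ⟩
    k                                ∎
    where open ℕₚ.≤-Reasoning

  weight-≤ : ∀ {M} → frame ⊆ M → Avoids M P → weight M ≤ (k + l) * N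
  weight-≤ {M} frame⊆M avoids = begin
    weight M                              ≤⟨ sumFin-mono row-≤ ⟩
    sumFin (λ i → l + N * 𝟙 (outside i))  ≡⟨ sumFin-+ (λ _ → l) (λ i → N * 𝟙 (outside i)) ⟩
    sumFin {N} (λ _ → l) + sumFin (λ i → N * 𝟙 (outside i))
                                          ≡⟨ cong₂ _+_ (sumFin-const N l) (sumFin-* N (𝟙 ∘ outside)) ⟩
    N * l + N * count outside             ≤⟨ ℕₚ.+-monoʳ-≤ (N * l) (ℕₚ.*-monoʳ-≤ N count-outside) ⟩
    N * l + N * k                         ≡⟨ solve 3 (λ N l k → N :* l :+ N :* k := (k :+ l) :* N) refl N l k ⟩
    (k + l) * N                           ∎
    where
    open ℕₚ.≤-Reasoning
    open +-*-Solver using (solve; _:+_; _:*_; _:=_)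

    row-≤ : ∀ i → count (M i) ≤ l + N * 𝟙 (outside i)
    row-≤ i with outside i in outside≡
    ... | true  = ℕₚ.≤-trans (count≤length (M i))
                             (ℕₚ.≤-trans (ℕₚ.≤-reflexive (sym (ℕₚ.*-identityʳ N))) (ℕₚ.m≤n+m _ l))
    ... | false = ℕₚ.≤-trans (ℕₚ.<⇒≤ (band-row-sparse frame⊆M avoids i outside≡))
                             (ℕₚ.≤-reflexive (sym (trans (cong (l +_) (ℕₚ.*-zeroʳ N)) (ℕₚ.+-identityʳ l))))

isSat-≤-linear : ∀ {k l} (P : Matrix k l) {a b} → P a b ≡ true → ∀ d →
                 ∃ λ s → IsSat P (d + k) (d + k) s × s ≤ (k + l) * (d + k)
isSat-≤-linear P one d =
  let open LinearUpperBound P one d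
      (M , sat , frame⊆M) = saturate P frame frame-avoids
      (s , isSat , s≤) = isSat-≤-weight P M sat
  in s , isSat , ℕₚ.≤-trans s≤ (weight-≤ frame⊆M (proj₁ sat))

rows≤weight : ∀ {m n} {M : Matrix m n} → (∀ i → ∃ λ j → M i j ≡ true) → m ≤ weight M
rows≤weight {m} {M = M} row-one = begin
  m                    ≡⟨ sym (ℕₚ.*-identityʳ m) ⟩
  m * 1                ≡⟨ sym (sumFin-const m 1) ⟩
  sumFin {m} (λ _ → 1) ≤⟨ sumFin-mono one≤count ⟩
  weight M             ∎
  where
  open ℕₚ.≤-Reasoning

  one≤count : ∀ i → 1 ≤ count (M i)
  one≤count i = let (j , one) = row-one i in
    ℕₚ.≤-trans (ℕₚ.≤-reflexive (cong 𝟙 (sym one))) (≤-sumFin (𝟙 ∘ M i) j)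

record OccurrenceThrough {k l m n} (P : Matrix k l) (M : Matrix m n) (i : Fin m) (j : Fin n) : Set where
  field
    rows     : Fin k → Fin m
    cols     : Fin l → Fin n
    rows-inc : StrictlyIncreasing rows
    cols-inc : StrictlyIncreasing cols
    embeds   : Embeds P (setOne M i j) rows cols
    a        : Fin k
    b        : Fin l
    one      : P a b ≡ true
    row-a    : rows a ≡ i
    col-b    : cols b ≡ j

occurrence-through : ∀ {k l m n} {P : Matrix k l} {M : Matrix m n} → Saturating P M →
                     ∀ {i j} → M i j ≡ false → OccurrenceThrough P M i j
occurrence-through {P = P} {M} (avoids , saturates) {i} {j} zero′
  with saturates i j zero′
... | rows , cols , rows-inc , cols-inc , embeds
  with Finₚ.any? (λ a → Finₚ.any? λ b → (P a b ≟ᵇ true) ×-dec (rows a Finₚ.≟ i) ×-dec (cols b Finₚ.≟ j))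
... | yes (a , b , one , row-a , col-b) = record
  { rows = rows ; cols = cols ; rows-inc = rows-inc ; cols-inc = cols-inc ; embeds = embeds
  ; a = a ; b = b ; one = one ; row-a = row-a ; col-b = col-b }
... | no missed = contradiction (rows , cols , rows-inc , cols-inc , embeds-M) avoids
  where
  embeds-M : Embeds P M rows cols
  embeds-M a b one = trans (sym (setOne-elsewhere {M = M} i j λ (row-a , col-b) → missed (a , b , one , row-a , col-b)))
                           (embeds a b one)

module BlockDiagonal {k₁ l₁ k₂ l₂} (A : Matrix k₁ l₁) (B : Matrix k₂ l₂) where

  P : Matrix (k₁ + k₂) (l₁ + l₂)
  P = blockDiag A B

  blockDiag-↑ˡ : ∀ x y → P (x ↑ˡ k₂) (y ↑ˡ l₂) ≡ A x y
  blockDiag-↑ˡ x y rewrite Finₚ.splitAt-↑ˡ k₁ x k₂ | Finₚ.splitAt-↑ˡ l₁ y l₂ = refl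

  blockDiag-one : ∀ {x y} → P x y ≡ true → (toℕ x < k₁ × toℕ y < l₁) ⊎ (k₁ ≤ toℕ x × l₁ ≤ toℕ y)
  blockDiag-one {x} {y} one with toℕ x <? k₁ | toℕ y <? l₁
  ... | yes x<k₁ | yes y<l₁ = inj₁ (x<k₁ , y<l₁)
  ... | no x≮k₁  | no y≮l₁  = inj₂ (ℕₚ.≮⇒≥ x≮k₁ , ℕₚ.≮⇒≥ y≮l₁)
  ... | yes x<k₁ | no y≮l₁  = contradiction (trans (sym one) off) λ ()
    where
    off : P x y ≡ false
    off rewrite Finₚ.splitAt-< k₁ x x<k₁ | Finₚ.splitAt-≥ l₁ y (ℕₚ.≮⇒≥ y≮l₁) = refl
  ... | no x≮k₁  | yes y<l₁ = contradiction (trans (sym one) off) λ ()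
    where
    off : P x y ≡ false
    off rewrite Finₚ.splitAt-≥ k₁ x (ℕₚ.≮⇒≥ x≮k₁) | Finₚ.splitAt-< l₁ y y<l₁ = refl

  module _ {m n} {M : Matrix m n} {r : Fin m} where

    InA InB : ∀ {j} → OccurrenceThrough P M r j → Set
    InA o = toℕ (OccurrenceThrough.a o) < k₁ × toℕ (OccurrenceThrough.b o) < l₁
    InB o = k₁ ≤ toℕ (OccurrenceThrough.a o) × l₁ ≤ toℕ (OccurrenceThrough.b o)

    classify : ∀ {j} (o : OccurrenceThrough P M r j) → InA o ⊎ InB o
    classify o = blockDiag-one (OccurrenceThrough.one o)

    -- The A-part of an occurrence through (r, j₂) lies above and left of (r, j₂), the B-part of an
    -- occurrence through (r, j₁) lies below and right of (r, j₁); for j₂ ≤ j₁ + 1 they fit together,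
    -- avoiding row r altogether.
    combine : ∀ {j₁ j₂} (o₁ : OccurrenceThrough P M r j₁) (o₂ : OccurrenceThrough P M r j₂) →
              InA o₁ → InB o₂ → toℕ j₂ ≤ suc (toℕ j₁) → Contains M P
    combine {j₁} {j₂} o₁ o₂ (a₁<k₁ , b₁<l₁) (k₁≤a₂ , l₁≤b₂) j₂≤1+j₁ =
      rows , cols , rows-inc , cols-inc , embeds
      where
      module O₁ = OccurrenceThrough o₁
      module O₂ = OccurrenceThrough o₂

      above-r : ∀ x → toℕ x < k₁ → toℕ (O₂.rows x) < toℕ r
      above-r x x<k₁ = subst (λ z → toℕ (O₂.rows x) < toℕ z) O₂.row-a
                             (O₂.rows-inc x O₂.a (ℕₚ.<-≤-trans x<k₁ k₁≤a₂))

      below-r : ∀ x → k₁ ≤ toℕ x → toℕ r < toℕ (O₁.rows x)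
      below-r x k₁≤x = subst (λ z → toℕ z < toℕ (O₁.rows x)) O₁.row-a
                             (O₁.rows-inc O₁.a x (ℕₚ.<-≤-trans a₁<k₁ k₁≤x))

      left-of : ∀ y → toℕ y < l₁ → toℕ (O₂.cols y) ≤ toℕ j₁
      left-of y y<l₁ = ℕ.s≤s⁻¹ (ℕₚ.<-≤-trans (subst (λ z → toℕ (O₂.cols y) < toℕ z) O₂.col-b
                                                   (O₂.cols-inc y O₂.b (ℕₚ.<-≤-trans y<l₁ l₁≤b₂)))
                                             j₂≤1+j₁)

      right-of : ∀ y → l₁ ≤ toℕ y → toℕ j₁ < toℕ (O₁.cols y)
      right-of y l₁≤y = subst (λ z → toℕ z < toℕ (O₁.cols y)) O₁.col-b
                              (O₁.cols-inc O₁.b y (ℕₚ.<-≤-trans b₁<l₁ l₁≤y))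

      rows : Fin (k₁ + k₂) → Fin m
      rows x with toℕ x <? k₁
      ... | yes _ = O₂.rows x
      ... | no _  = O₁.rows x

      cols : Fin (l₁ + l₂) → Fin n
      cols y with toℕ y <? l₁
      ... | yes _ = O₂.cols y
      ... | no _  = O₁.cols y

      rows-inc : StrictlyIncreasing rows
      rows-inc x y x<y with toℕ x <? k₁ | toℕ y <? k₁
      ... | yes _    | yes _    = O₂.rows-inc x y x<y
      ... | yes x<k₁ | no y≮k₁  = ℕₚ.<-trans (above-r x x<k₁) (below-r y (ℕₚ.≮⇒≥ y≮k₁))
      ... | no x≮k₁  | yes y<k₁ = contradiction (ℕₚ.<-trans x<y y<k₁) x≮k₁
      ... | no _     | no _     = O₁.rows-inc x y x<y

      cols-inc : StrictlyIncreasing cols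
      cols-inc x y x<y with toℕ x <? l₁ | toℕ y <? l₁
      ... | yes _    | yes _    = O₂.cols-inc x y x<y
      ... | yes x<l₁ | no y≮l₁  = ℕₚ.≤-<-trans (left-of x x<l₁) (right-of y (ℕₚ.≮⇒≥ y≮l₁))
      ... | no x≮l₁  | yes y<l₁ = contradiction (ℕₚ.<-trans x<y y<l₁) x≮l₁
      ... | no _     | no _     = O₁.cols-inc x y x<y

      embeds : Embeds P M rows cols
      embeds x y one with toℕ x <? k₁ | toℕ y <? l₁ | blockDiag-one one
      ... | yes x<k₁ | yes _ | _ =
        trans (sym (setOne-elsewhere {M = M} r j₂ λ (x↦r , _) →
                      ℕₚ.<-irrefl (cong toℕ x↦r) (above-r x x<k₁)))
              (O₂.embeds x y one)
      ... | no x≮k₁ | no _ | _ =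
        trans (sym (setOne-elsewhere {M = M} r j₁ λ (x↦r , _) →
                      ℕₚ.<-irrefl (cong toℕ (sym x↦r)) (below-r x (ℕₚ.≮⇒≥ x≮k₁))))
              (O₁.embeds x y one)
      ... | yes _    | no y≮l₁  | inj₁ (_ , y<l₁)  = contradiction y<l₁ y≮l₁
      ... | yes x<k₁ | no _     | inj₂ (k₁≤x , _)  = contradiction k₁≤x (ℕₚ.<⇒≱ x<k₁)
      ... | no x≮k₁  | yes _    | inj₁ (x<k₁ , _)  = contradiction x<k₁ x≮k₁
      ... | no _     | yes y<l₁ | inj₂ (_ , l₁≤y)  = contradiction l₁≤y (ℕₚ.<⇒≱ y<l₁)

  saturating-row-has-one : Fin l₁ → Fin l₂ → ∀ {m n} {M : Matrix m (suc n)} → Saturating P M →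
                           ∀ r → ∃ λ j → M r j ≡ true
  saturating-row-has-one bA bB {n = n} {M} sat r with Finₚ.any? (λ j → M r j ≟ᵇ true)
  ... | yes row-one = row-one
  ... | no empty = contradiction (all-InA (fromℕ n)) λ (o , _ , b<l₁) → no-InA-last o b<l₁
    where
    through : ∀ j → OccurrenceThrough P M r j
    through j = occurrence-through sat (¬-not λ one → empty (j , one))

    columnA columnB : Fin (l₁ + l₂)
    columnA = bA ↑ˡ l₂
    columnB = l₁ ↑ʳ bB

    columnA<l₁ : toℕ columnA < l₁
    columnA<l₁ = subst (_< l₁) (sym (Finₚ.toℕ-↑ˡ bA l₂)) (Finₚ.toℕ<n bA)

    l₁≤columnB : l₁ ≤ toℕ columnB
    l₁≤columnB = subst (l₁ ≤_) (sym (Finₚ.toℕ-↑ʳ l₁ bB)) (ℕₚ.m≤m+n l₁ (toℕ bB))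

    no-InB-first : (o : OccurrenceThrough P M r zero) → ¬ l₁ ≤ toℕ (OccurrenceThrough.b o)
    no-InB-first o l₁≤b = ℕₚ.n≮0 (subst (λ z → toℕ (O.cols columnA) < toℕ z) O.col-b
                                        (O.cols-inc columnA O.b (ℕₚ.<-≤-trans columnA<l₁ l₁≤b)))
      where module O = OccurrenceThrough o

    no-InA-last : (o : OccurrenceThrough P M r (fromℕ n)) → ¬ toℕ (OccurrenceThrough.b o) < l₁
    no-InA-last o b<l₁ = ℕₚ.<-irrefl refl (ℕₚ.<-≤-trans n<col (ℕ.s≤s⁻¹ (Finₚ.toℕ<n (O.cols columnB))))
      where
      module O = OccurrenceThrough o
      n<col : n < toℕ (O.cols columnB)
      n<col = subst (_< toℕ (O.cols columnB)) (trans (cong toℕ O.col-b) (Finₚ.toℕ-fromℕ n))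
                    (O.cols-inc O.b columnB (ℕₚ.<-≤-trans b<l₁ l₁≤columnB))

    HasInA : Fin (suc n) → Set
    HasInA j = Σ (OccurrenceThrough P M r j) InA

    all-InA : ∀ j → HasInA j
    all-InA = <-weakInduction HasInA first next
      where
      first : HasInA zero
      first with classify (through zero)
      ... | inj₁ inA         = through zero , inA
      ... | inj₂ (_ , l₁≤b)  = contradiction l₁≤b (no-InB-first (through zero))

      next : ∀ i → HasInA (inject₁ i) → HasInA (suc i)
      next i (o₁ , inA) with classify (through (suc i))
      ... | inj₁ inA′ = through (suc i) , inA′
      ... | inj₂ inB  = contradiction (combine o₁ (through (suc i)) inA inB
                          (s≤s (ℕₚ.≤-reflexive (sym (Finₚ.toℕ-inject₁ i))))) (proj₁ sat)

  isSat-≥ : Fin l₁ → Fin l₂ → ∀ {n s} → IsSat P n n s → n ≤ s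
  isSat-≥ bA bB {zero}  _ = z≤n
  isSat-≥ bA bB {suc n} ((M , sat , refl) , _) = rows≤weight (saturating-row-has-one bA bB sat)

theorem5 : ∀ {k₁ l₁ k₂ l₂} (A : Matrix k₁ l₁) (B : Matrix k₂ l₂) →
    NonZeroMatrix A → NonZeroMatrix B →
    ∃ λ n₀ → ∃ λ c₁ → ∃ λ c₂ → ∀ n → n₀ ≤ n →
      Σ ℕ λ s → IsSat (blockDiag A B) n n s × n ≤ c₁ * s × s ≤ c₂ * n
theorem5 {k₁} {l₁} {k₂} {l₂} A B (a , b , A-one) (_ , b′ , _) =
  k , 1 , k + l , λ n k≤n → subst Bounds (ℕₚ.m∸n+n≡m k≤n) (bounds (n ∸ k))
  where
  open BlockDiagonal A B using (P; blockDiag-↑ˡ; isSat-≥)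

  k l : ℕ
  k = k₁ + k₂
  l = l₁ + l₂

  Bounds : ℕ → Set
  Bounds n = Σ ℕ λ s → IsSat P n n s × n ≤ 1 * s × s ≤ (k + l) * n

  bounds : ∀ d → Bounds (d + k)
  bounds d =
    let (s , isSat , s≤) = isSat-≤-linear P (trans (blockDiag-↑ˡ a b) A-one) d
    in s , isSat , subst (d + k ≤_) (sym (ℕₚ.*-identityˡ s)) (isSat-≥ b b′ isSat) , s≤
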